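{- Let $A$ be a formula, $\Phi$ a constraint set, $x_1,\dots,x_n$ resource variables not free in $\Phi$, and $p_1,\dots,p_n,q_1,\dots,q_n$ resource polynomials with $p_i\sqsubseteq_\Phi q_i$ for all $i$. If $x_1,\dots,x_n$ occur only positively in $A$, then $A\{\overline{p}/\overline{x}\}\le_\Phi A\{\overline{q}/\overline{x}\}$; if they occur only negatively in $A$, then $A\{\overline{q}/\overline{x}\}\le_\Phi A\{\overline{p}/\overline{x}\}$.
   Context: Resource polynomials: finite sums of finite products $\prod_i\binom{x_i}{n_i}$ (pairwise distinct variables $x_i$, $n_i\in\mathbb{N}$), read as functions of natural-number variables. A constraint is $p\le q$ for resource polynomials $p,q$; $p<q$ abbreviates $p+1\le q$; a constraint set is a finite set of constraints. $\Phi\models c$ means every assignment of naturals to variables satisfying all of $\Phi$ satisfies $c$; $\Phi\models\Psi$ means $\Phi\models c$ for all $c\in\Psi$; $p\sqsubseteq_\Phi q$ means $\Phi\models p\le q$. Formulas: $A::=\alpha(p_1,\dots,p_n)\mid A\otimes A\mid A\multimap A\mid\forall\alpha.A\mid\,!_{x<p}A\mid\forall(x_1,\dots,x_n){:}\Phi.A\mid\exists(x_1,\dots,x_n){:}\Phi.A$, where $\alpha$ ranges over atoms with fixed arities, the $p_i,p$ are resource polynomials, $x\notin FV(p)$, $\Phi$ a constraint set, and (boundedness) for each quantifier formula there are resource polynomials $r_i$ not containing $\overline{x}$ with $\Phi\models\{x_i\le r_i\}_i$. $!_{x<p}$ binds $x$ in its body, first-order quantifiers bind $\overline{x}$ in $\Phi$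 and the body, $\forall\alpha$ binds $\alpha$; formulas are taken up to renaming of bound variables and $A\{\overline{p}/\overline{x}\}$ is capture-avoiding simultaneous substitution. Polarity of free occurrences of resource variables: variables in $p_1,\dots,p_n$ occur positively in $\alpha(p_1,\dots,p_n)$; in a constraint $p\le q$ variables of $p$ are negative and of $q$ positive; polarity is reversed when passing into the first argument of $\multimap$, into the bound $p$ of $!_{x<p}$, and into the constraint set $\Phi$ of $\forall\overline{x}{:}\Phi$; it is preserved in all other positions (both sides of $\otimes$, second argument of $\multimap$, bodies of $\forall\alpha$, $!$ and the quantifiers, and the constraint set of $\exists\overline{x}{:}\Phi$). Order on formulas: $\alpha(\overline{p})\le_\Phi\alpha(\overline{q})$ iff $p_i\sqsubseteq_\Phi q_i$ for all $i$; $A\otimes B\le_\Phi C\otimes D$ iff $A\le_\Phi C$ and $B\le_\Phi D$; $A\multimap B\le_\Phi C\multimap D$ iff $C\le_\Phi A$ and $B\le_\Phi D$; $\forall\alpha.A\le_\Phi\forall\alpha.B$ iff $A\le_\Phi B$; $!_{x<p}A\le_\Phi\,!_{x<q}B$ iff $q\sqsubseteq_\Phi p$, $x\notin FV(\Phi)$, $A\le_{\Phi\cup\{x<q\}}B$; $\forall\overline{x}{:}\Psi.A\le_\Phi\forall\overline{x}{:}\Theta.B$ iff $\Phi\cup\Theta\models\Psi$, $\overline{x}\notin FV(\Phi)$, $A\le_{\Phi\cup\Theta}B$; $\exists\overline{x}{:}\Psi.A\le_\Phi\exists\overline{x}{:}\Theta.B$ iff $\Phi\cup\Psi\models\Theta$,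 $\overline{x}\notin FV(\Phi)$, $A\le_{\Phi\cup\Psi}B$. -}

module Defs where

open import Data.Nat using (ℕ; zero; suc; _+_; _*_; _∸_; _≤_; _<?_)
open import Data.Nat.Properties using (_≟_)
open import Data.Nat.Combinatorics using (_C_)
open import Data.Fin using (Fin)
open import Data.Vec using (Vec; []; _∷_; lookup)
open import Data.List using (List; []; _∷_; map; _++_; [_])
open import Data.List.Relation.Unary.All using (All)
open import Data.List.Relation.Unary.Any using (Any)
open import Data.List.Relation.Unary.Unique.Propositional using (Unique)
open import Data.List.Relation.Binary.Pointwise using (Pointwise)
open import Data.Product using (Σ; _×_; _,_; proj₁)
open import Data.Sum using (_⊎_)
open import Data.Unit using (⊤)
open import Data.Empty using (⊥)
open import Relation.Nullary using (¬_; yes; no)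
open import Relation.Binary.PropositionalEquality using (_≡_)

-- Resource variables are de Bruijn indices (ℕ).  Binders of formulas
-- bind the lowest indices; free variables of the whole formula are the
-- indices at top level.  This realises "formulas up to renaming of bound
-- variables" and capture-avoiding substitution.

-- Polynomial expressions (closed under substitution).
data Poly : Set where
  var   : ℕ → Poly
  pzero : Poly
  pone  : Poly
  _⊕_   : Poly → Poly → Poly
  _⊛_   : Poly → Poly → Poly
  bin   : Poly → ℕ → Poly

-- Resource polynomials in their syntactic normal form:
-- a finite sum of finite products  ∏ (x_i choose n_i).
Mono : Set
Mono = List (ℕ × ℕ)

RPoly : Set
RPoly = List Mono

monoToPoly : Mono → Poly
monoToPoly []            = pone
monoToPoly ((x , k) ∷ m) = bin (var x) k ⊛ monoToPoly m

toPoly : RPoly → Poly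
toPoly []      = pzero
toPoly (m ∷ r) = monoToPoly m ⊕ toPoly r

WFRPoly : RPoly → Set
WFRPoly r = All (λ m → Unique (map proj₁ m)) r

IsRP : Poly → Set
IsRP e = Σ RPoly (λ r → WFRPoly r × toPoly r ≡ e)

⟦_⟧ : Poly → (ℕ → ℕ) → ℕ
⟦ var x ⟧   ρ = ρ x
⟦ pzero ⟧   ρ = 0
⟦ pone ⟧    ρ = 1
⟦ e ⊕ f ⟧   ρ = ⟦ e ⟧ ρ + ⟦ f ⟧ ρ
⟦ e ⊛ f ⟧   ρ = ⟦ e ⟧ ρ * ⟦ f ⟧ ρ
⟦ bin e k ⟧ ρ = ⟦ e ⟧ ρ C k

OccP : ℕ → Poly → Set
OccP x (var y)   = x ≡ y
OccP x pzero     = ⊥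
OccP x pone      = ⊥
OccP x (e ⊕ f)   = OccP x e ⊎ OccP x f
OccP x (e ⊛ f)   = OccP x e ⊎ OccP x f
OccP x (bin e k) = OccP x e

wk : ℕ → Poly → Poly
wk k (var y)   = var (k + y)
wk k pzero     = pzero
wk k pone      = pone
wk k (e ⊕ f)   = wk k e ⊕ wk k f
wk k (e ⊛ f)   = wk k e ⊛ wk k f
wk k (bin e n) = bin (wk k e) n

substP : (ℕ → Poly) → Poly → Poly
substP σ (var y)   = σ y
substP σ pzero     = pzero
substP σ pone      = pone
substP σ (e ⊕ f)   = substP σ e ⊕ substP σ f
substP σ (e ⊛ f)   = substP σ e ⊛ substP σ f
substP σ (bin e n) = bin (substP σ e) n

lift : ℕ → (ℕ → Poly) → ℕ → Poly
lift k σ i with i <? k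
... | yes _ = var i
... | no  _ = wk k (σ (i ∸ k))

record Constraint : Set where
  constructor _≤c_
  field
    lhs : Poly
    rhs : Poly
open Constraint public

_<c_ : Poly → Poly → Constraint
p <c q = (p ⊕ pone) ≤c q

Sat : (ℕ → ℕ) → Constraint → Set
Sat ρ (p ≤c q) = ⟦ p ⟧ ρ ≤ ⟦ q ⟧ ρ

CSet : Set
CSet = List Constraint

_⊨_ : CSet → Constraint → Set
Φ ⊨ c = (ρ : ℕ → ℕ) → All (Sat ρ) Φ → Sat ρ c

_⊨*_ : CSet → CSet → Set
Φ ⊨* Ψ = All (Φ ⊨_) Ψ

infix 4 _⊑[_]_
_⊑[_]_ : Poly → CSet → Poly → Set
p ⊑[ Φ ] q = Φ ⊨ (p ≤c q)

wkC : ℕ → CSet → CSet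
wkC k Φ = map (λ { (p ≤c q) → wk k p ≤c wk k q }) Φ

substC : (ℕ → Poly) → CSet → CSet
substC σ Φ = map (λ { (p ≤c q) → substP σ p ≤c substP σ q }) Φ

IsRPC : CSet → Set
IsRPC Φ = All (λ c → IsRP (lhs c) × IsRP (rhs c)) Φ

OccC : ℕ → CSet → Set
OccC x Φ = Any (λ c → OccP x (lhs c) ⊎ OccP x (rhs c)) Φ

-- Atoms (second-order variables α) are de Bruijn indices too,
-- bound by ∀α.  Quantifiers over resource variables bind k variables
-- (indices 0 … k-1 in their constraint set and body); !_{x<p} binds one
-- (index 0 in its body; p lives in the outer scope, so x ∉ FV(p)).

data Form : Set where
  atom : ℕ → List Poly → Form
  _⊗_  : Form → Form → Form
  _⊸_  : Form → Form → Form
  ∀α   : Form → Form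
  bang : Poly → Form → Form
  ∀r   : (k : ℕ) → CSet → Form → Form
  ∃r   : (k : ℕ) → CSet → Form → Form

Bounded : ℕ → CSet → Set
Bounded k Φ = (i : Fin k) →
  Σ Poly (λ r → IsRP r × ((j : ℕ) → j Data.Nat.< k → ¬ OccP j r)
                × Φ ⊨ (var (Data.Fin.toℕ i) ≤c r))

WF : Form → Set
WF (atom a ps)  = All IsRP ps
WF (A ⊗ B)      = WF A × WF B
WF (A ⊸ B)      = WF A × WF B
WF (∀α A)       = WF A
WF (bang p A)   = IsRP p × WF A
WF (∀r k Φ A)   = IsRPC Φ × Bounded k Φ × WF A
WF (∃r k Φ A)   = IsRPC Φ × Bounded k Φ × WF A

subst : (ℕ → Poly) → Form → Form
subst σ (atom a ps) = atom a (map (substP σ) ps)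
subst σ (A ⊗ B)     = subst σ A ⊗ subst σ B
subst σ (A ⊸ B)     = subst σ A ⊸ subst σ B
subst σ (∀α A)      = ∀α (subst σ A)
subst σ (bang p A)  = bang (substP σ p) (subst (lift 1 σ) A)
subst σ (∀r k Φ A)  = ∀r k (substC (lift k σ) Φ) (subst (lift k σ) A)
subst σ (∃r k Φ A)  = ∃r k (substC (lift k σ) Φ) (subst (lift k σ) A)

substOf : {n : ℕ} → Vec ℕ n → Vec Poly n → ℕ → Poly
substOf []       []       x = var x
substOf (y ∷ ys) (p ∷ ps) x with x ≟ y
... | yes _ = p
... | no  _ = substOf ys ps x

infix 30 _[_/_]
_[_/_] : {n : ℕ} → Form → Vec Poly n → Vec ℕ n → Form
A [ ps / xs ] = subst (substOf xs ps) A

data Pol : Set where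
  pos neg : Pol

flip : Pol → Pol
flip pos = neg
flip neg = pos

OccCS : Pol → ℕ → CSet → Set
OccCS s x Φ = Any (λ c → (s ≡ neg × OccP x (lhs c)) ⊎ (s ≡ pos × OccP x (rhs c))) Φ

Occ : Pol → ℕ → Form → Set
Occ s x (atom a ps) = s ≡ pos × Any (OccP x) ps
Occ s x (A ⊗ B)     = Occ s x A ⊎ Occ s x B
Occ s x (A ⊸ B)     = Occ (flip s) x A ⊎ Occ s x B
Occ s x (∀α A)      = Occ s x A
Occ s x (bang p A)  = (flip s ≡ pos × OccP x p) ⊎ Occ s (suc x) A
Occ s x (∀r k Φ A)  = OccCS (flip s) (k + x) Φ ⊎ Occ s (k + x) A
Occ s x (∃r k Φ A)  = OccCS s (k + x) Φ ⊎ Occ s (k + x) A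

infix 4 _≤[_]_
_≤[_]_ : Form → CSet → Form → Set
atom a ps  ≤[ Φ ] atom b qs  = a ≡ b × Pointwise (λ p q → p ⊑[ Φ ] q) ps qs
(A ⊗ B)    ≤[ Φ ] (C ⊗ D)    = A ≤[ Φ ] C × B ≤[ Φ ] D
(A ⊸ B)    ≤[ Φ ] (C ⊸ D)    = C ≤[ Φ ] A × B ≤[ Φ ] D
∀α A       ≤[ Φ ] ∀α B       = A ≤[ Φ ] B
bang p A   ≤[ Φ ] bang q B   =
  q ⊑[ Φ ] p × A ≤[ wkC 1 Φ ++ [ var 0 <c wk 1 q ] ] B
∀r k Ψ A   ≤[ Φ ] ∀r k′ Θ B  =
  k ≡ k′ × (wkC k Φ ++ Θ) ⊨* Ψ × A ≤[ wkC k Φ ++ Θ ] B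
∃r k Ψ A   ≤[ Φ ] ∃r k′ Θ B  =
  k ≡ k′ × (wkC k Φ ++ Ψ) ⊨* Θ × A ≤[ wkC k Φ ++ Ψ ] B
_          ≤[ Φ ] _          = ⊥

-- We prove more: for arbitrary substitutions σ, τ with σ y ⊑_Φ τ y for every
-- variable y, A{σ} ≤_Φ A{τ} as soon as σ and τ have the same value on every
-- variable occurring negatively in A (dually for A{τ} ≤_Φ A{σ}).  This goes by
-- induction on A: resource polynomials are monotone in their variables, since
-- +, * and (− choose k) are; at a contravariant position the agreement turns
-- the required reverse inequality into an equality; and lifting under a
-- binder preserves both hypotheses, because every order clause for a binder
-- extends the context by the weakened Φ.
-- The order is semantic and substitution never acts on Φ.
module Submission where

open import Defs
open import Data.Nat using (ℕ; suc; _+_; _*_; _∸_; _≤_; _<?_; _≤′_; ≤′-refl; ≤′-step)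
open import Data.Nat.Properties using (_≟_; ≤-refl; ≤-trans; ≤-reflexive; +-mono-≤; *-mono-≤; m≤n+m; ≮⇒≥; m+[n∸m]≡n; ≤⇒≤′)
open import Data.Nat.Combinatorics using (_C_; nCk+nC[k+1]≡[n+1]C[k+1])
open import Data.Fin using (Fin)
open import Data.Fin.Base using () renaming (zero to fzero; suc to fsuc)
open import Data.Vec using (Vec; lookup; []; _∷_)
open import Data.Vec.Relation.Unary.All using (All)
open import Data.List using ([]; _∷_; map; _++_)
open import Data.List.Relation.Unary.All as List using ([]; _∷_)
open import Data.List.Relation.Unary.All.Properties using (++⁻ˡ; ++⁻ʳ)
open import Data.List.Relation.Unary.Any using (Any; here; there)
open import Data.List.Relation.Binary.Pointwise using (Pointwise; []; _∷_)
open import Data.Product using (_×_; _,_)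
open import Data.Sum using (inj₁; inj₂)
open import Data.Empty using (⊥-elim)
open import Function using (_∘_)
open import Relation.Nullary using (¬_; yes; no)
open import Relation.Binary.PropositionalEquality
  using (_≡_; refl; sym; trans; cong; cong₂; subst₂)
  renaming (subst to ≡-subst)

nCk≤[n+1]Ck : ∀ n k → n C k ≤ suc n C k
nCk≤[n+1]Ck n 0       = ≤-refl
nCk≤[n+1]Ck n (suc k) =
  ≡-subst (n C suc k ≤_) (nCk+nC[k+1]≡[n+1]C[k+1] n k) (m≤n+m (n C suc k) (n C k))

m≤n⇒mCk≤nCk : ∀ {m n} k → m ≤ n → m C k ≤ n C k
m≤n⇒mCk≤nCk k = go ∘ ≤⇒≤′
  where
  go : ∀ {m n} → m ≤′ n → m C k ≤ n C k
  go ≤′-refl                   = ≤-refl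
  go {n = suc n} (≤′-step m≤n) = ≤-trans (go m≤n) (nCk≤[n+1]Ck n k)

Subst : Set
Subst = ℕ → Poly

infix 4 _≤ₛ[_]_
_≤ₛ[_]_ : Subst → CSet → Subst → Set
σ ≤ₛ[ Φ ] τ = ∀ y → σ y ⊑[ Φ ] τ y

Agree : Subst → Subst → ℕ → Set
Agree σ τ y = ∀ ρ → ⟦ σ y ⟧ ρ ≡ ⟦ τ y ⟧ ρ

AgreeOn : (ℕ → Set) → Subst → Subst → Set
AgreeOn P σ τ = ∀ y → P y → Agree σ τ y

⟦substP⟧-mono : ∀ e {σ τ ρ} → (∀ y → ⟦ σ y ⟧ ρ ≤ ⟦ τ y ⟧ ρ)
  → ⟦ substP σ e ⟧ ρ ≤ ⟦ substP τ e ⟧ ρ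
⟦substP⟧-mono (var x)   σ≤τ = σ≤τ x
⟦substP⟧-mono pzero     σ≤τ = ≤-refl
⟦substP⟧-mono pone      σ≤τ = ≤-refl
⟦substP⟧-mono (e ⊕ f)   σ≤τ = +-mono-≤ (⟦substP⟧-mono e σ≤τ) (⟦substP⟧-mono f σ≤τ)
⟦substP⟧-mono (e ⊛ f)   σ≤τ = *-mono-≤ (⟦substP⟧-mono e σ≤τ) (⟦substP⟧-mono f σ≤τ)
⟦substP⟧-mono (bin e k) σ≤τ = m≤n⇒mCk≤nCk k (⟦substP⟧-mono e σ≤τ)

⟦substP⟧-cong : ∀ e {σ τ} → AgreeOn (λ y → OccP y e) σ τ
  → ∀ ρ → ⟦ substP σ e ⟧ ρ ≡ ⟦ substP τ e ⟧ ρ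
⟦substP⟧-cong (var x)   σ≈τ = σ≈τ x refl
⟦substP⟧-cong pzero     σ≈τ ρ = refl
⟦substP⟧-cong pone      σ≈τ ρ = refl
⟦substP⟧-cong (e ⊕ f)   σ≈τ ρ =
  cong₂ _+_ (⟦substP⟧-cong e (λ y → σ≈τ y ∘ inj₁) ρ) (⟦substP⟧-cong f (λ y → σ≈τ y ∘ inj₂) ρ)
⟦substP⟧-cong (e ⊛ f)   σ≈τ ρ =
  cong₂ _*_ (⟦substP⟧-cong e (λ y → σ≈τ y ∘ inj₁) ρ) (⟦substP⟧-cong f (λ y → σ≈τ y ∘ inj₂) ρ)
⟦substP⟧-cong (bin e k) σ≈τ ρ = cong (_C k) (⟦substP⟧-cong e σ≈τ ρ)

substP-⊑-mono : ∀ e {Φ σ τ} → σ ≤ₛ[ Φ ] τ → substP σ e ⊑[ Φ ] substP τ e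
substP-⊑-mono e σ≤τ ρ sat = ⟦substP⟧-mono e (λ y → σ≤τ y ρ sat)

substP-⊑-agree : ∀ e {Φ σ τ} → AgreeOn (λ y → OccP y e) σ τ → substP τ e ⊑[ Φ ] substP σ e
substP-⊑-agree e σ≈τ ρ _ = ≤-reflexive (sym (⟦substP⟧-cong e σ≈τ ρ))

⟦wk⟧ : ∀ k e ρ → ⟦ wk k e ⟧ ρ ≡ ⟦ e ⟧ (ρ ∘ (k +_))
⟦wk⟧ k (var x)   ρ = refl
⟦wk⟧ k pzero     ρ = refl
⟦wk⟧ k pone      ρ = refl
⟦wk⟧ k (e ⊕ f)   ρ = cong₂ _+_ (⟦wk⟧ k e ρ) (⟦wk⟧ k f ρ)
⟦wk⟧ k (e ⊛ f)   ρ = cong₂ _*_ (⟦wk⟧ k e ρ) (⟦wk⟧ k f ρ)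
⟦wk⟧ k (bin e n) ρ = cong (_C n) (⟦wk⟧ k e ρ)

Sat-wkC : ∀ k Φ {ρ} → List.All (Sat ρ) (wkC k Φ) → List.All (Sat (ρ ∘ (k +_))) Φ
Sat-wkC k []              []         = []
Sat-wkC k ((p ≤c q) ∷ Φ) {ρ} (s ∷ sat) =
  subst₂ _≤_ (⟦wk⟧ k p ρ) (⟦wk⟧ k q ρ) s ∷ Sat-wkC k Φ sat

lift-≤ₛ : ∀ k {Φ Θ σ τ} → σ ≤ₛ[ Φ ] τ → lift k σ ≤ₛ[ wkC k Φ ++ Θ ] lift k τ
lift-≤ₛ k {σ = σ} {τ} σ≤τ i ρ sat with i <? k
... | yes _ = ≤-refl
... | no  _ =
  subst₂ _≤_ (sym (⟦wk⟧ k (σ (i ∸ k)) ρ)) (sym (⟦wk⟧ k (τ (i ∸ k)) ρ))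
    (σ≤τ (i ∸ k) (ρ ∘ (k +_)) (Sat-wkC k _ (++⁻ˡ (wkC k _) sat)))

lift-agreeOn : ∀ k {P σ τ} → AgreeOn (P ∘ (k +_)) σ τ → AgreeOn P (lift k σ) (lift k τ)
lift-agreeOn k {P} {σ} {τ} σ≈τ i Pi ρ with i <? k
... | yes _   = refl
... | no  i≮k =
  trans (⟦wk⟧ k (σ (i ∸ k)) ρ)
    (trans (σ≈τ (i ∸ k) (≡-subst P (sym (m+[n∸m]≡n (≮⇒≥ i≮k))) Pi) (ρ ∘ (k +_)))
      (sym (⟦wk⟧ k (τ (i ∸ k)) ρ)))

⊨*-++ʳ : ∀ Δ {Ψ} → (Δ ++ Ψ) ⊨* Ψ
⊨*-++ʳ Δ = List.tabulate (λ c∈Ψ ρ sat → List.lookup (++⁻ʳ Δ sat) c∈Ψ)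

substC-⊨*-mono : ∀ Ψ {Γ σ τ} → σ ≤ₛ[ Γ ] τ → AgreeOn (λ y → OccCS pos y Ψ) σ τ
  → Γ ⊨* substC τ Ψ → Γ ⊨* substC σ Ψ
substC-⊨*-mono []              σ≤τ σ≈τ []             = []
substC-⊨*-mono ((l ≤c r) ∷ Ψ) σ≤τ σ≈τ (τl≤τr ∷ τΨ) =
  (λ ρ sat → ≤-trans (substP-⊑-mono l σ≤τ ρ sat)
               (≤-trans (τl≤τr ρ sat)
                 (substP-⊑-agree r (λ y → σ≈τ y ∘ here ∘ inj₂ ∘ (refl ,_)) ρ sat)))
  ∷ substC-⊨*-mono Ψ σ≤τ (λ y → σ≈τ y ∘ there) τΨ

substC-⊨*-anti : ∀ Ψ {Γ σ τ} → σ ≤ₛ[ Γ ] τ → AgreeOn (λ y → OccCS neg y Ψ) σ τ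
  → Γ ⊨* substC σ Ψ → Γ ⊨* substC τ Ψ
substC-⊨*-anti []              σ≤τ σ≈τ []             = []
substC-⊨*-anti ((l ≤c r) ∷ Ψ) σ≤τ σ≈τ (σl≤σr ∷ σΨ) =
  (λ ρ sat → ≤-trans (substP-⊑-agree l (λ y → σ≈τ y ∘ here ∘ inj₁ ∘ (refl ,_)) ρ sat)
               (≤-trans (σl≤σr ρ sat) (substP-⊑-mono r σ≤τ ρ sat)))
  ∷ substC-⊨*-anti Ψ σ≤τ (λ y → σ≈τ y ∘ there) σΨ

map-substP-⊑-mono : ∀ ps {Φ σ τ} → σ ≤ₛ[ Φ ] τ
  → Pointwise _⊑[ Φ ]_ (map (substP σ) ps) (map (substP τ) ps)
map-substP-⊑-mono []       σ≤τ = []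
map-substP-⊑-mono (p ∷ ps) σ≤τ = substP-⊑-mono p σ≤τ ∷ map-substP-⊑-mono ps σ≤τ

map-substP-⊑-agree : ∀ ps {Φ σ τ} → AgreeOn (λ y → Any (OccP y) ps) σ τ
  → Pointwise _⊑[ Φ ]_ (map (substP τ) ps) (map (substP σ) ps)
map-substP-⊑-agree []       σ≈τ = []
map-substP-⊑-agree (p ∷ ps) σ≈τ =
  substP-⊑-agree p (λ y → σ≈τ y ∘ here) ∷ map-substP-⊑-agree ps (λ y → σ≈τ y ∘ there)

subst-mono : ∀ A {Φ σ τ} → σ ≤ₛ[ Φ ] τ → AgreeOn (λ y → Occ neg y A) σ τ
  → subst σ A ≤[ Φ ] subst τ A
subst-anti : ∀ A {Φ σ τ} → σ ≤ₛ[ Φ ] τ → AgreeOn (λ y → Occ pos y A) σ τ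
  → subst τ A ≤[ Φ ] subst σ A

subst-mono (atom a ps) σ≤τ σ≈τ = refl , map-substP-⊑-mono ps σ≤τ
subst-mono (A ⊗ B)     σ≤τ σ≈τ =
  subst-mono A σ≤τ (λ y → σ≈τ y ∘ inj₁) , subst-mono B σ≤τ (λ y → σ≈τ y ∘ inj₂)
subst-mono (A ⊸ B)     σ≤τ σ≈τ =
  subst-anti A σ≤τ (λ y → σ≈τ y ∘ inj₁) , subst-mono B σ≤τ (λ y → σ≈τ y ∘ inj₂)
subst-mono (∀α A)      σ≤τ σ≈τ = subst-mono A σ≤τ σ≈τ
subst-mono (bang p A)  σ≤τ σ≈τ =
  substP-⊑-agree p (λ y → σ≈τ y ∘ inj₁ ∘ (refl ,_)) ,
  subst-mono A (lift-≤ₛ 1 σ≤τ) (lift-agreeOn 1 (λ y → σ≈τ y ∘ inj₂))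
subst-mono (∀r k Ψ A)  {Φ} σ≤τ σ≈τ =
  refl ,
  substC-⊨*-mono Ψ (lift-≤ₛ k σ≤τ) (lift-agreeOn k (λ y → σ≈τ y ∘ inj₁))
    (⊨*-++ʳ (wkC k Φ)) ,
  subst-mono A (lift-≤ₛ k σ≤τ) (lift-agreeOn k (λ y → σ≈τ y ∘ inj₂))
subst-mono (∃r k Ψ A)  {Φ} σ≤τ σ≈τ =
  refl ,
  substC-⊨*-anti Ψ (lift-≤ₛ k σ≤τ) (lift-agreeOn k (λ y → σ≈τ y ∘ inj₁))
    (⊨*-++ʳ (wkC k Φ)) ,
  subst-mono A (lift-≤ₛ k σ≤τ) (lift-agreeOn k (λ y → σ≈τ y ∘ inj₂))

subst-anti (atom a ps) σ≤τ σ≈τ = refl , map-substP-⊑-agree ps (λ y → σ≈τ y ∘ (refl ,_))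
subst-anti (A ⊗ B)     σ≤τ σ≈τ =
  subst-anti A σ≤τ (λ y → σ≈τ y ∘ inj₁) , subst-anti B σ≤τ (λ y → σ≈τ y ∘ inj₂)
subst-anti (A ⊸ B)     σ≤τ σ≈τ =
  subst-mono A σ≤τ (λ y → σ≈τ y ∘ inj₁) , subst-anti B σ≤τ (λ y → σ≈τ y ∘ inj₂)
subst-anti (∀α A)      σ≤τ σ≈τ = subst-anti A σ≤τ σ≈τ
subst-anti (bang p A)  σ≤τ σ≈τ =
  substP-⊑-mono p σ≤τ ,
  subst-anti A (lift-≤ₛ 1 σ≤τ) (lift-agreeOn 1 (λ y → σ≈τ y ∘ inj₂))
subst-anti (∀r k Ψ A)  {Φ} σ≤τ σ≈τ =
  refl ,
  substC-⊨*-anti Ψ (lift-≤ₛ k σ≤τ) (lift-agreeOn k (λ y → σ≈τ y ∘ inj₁))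
    (⊨*-++ʳ (wkC k Φ)) ,
  subst-anti A (lift-≤ₛ k σ≤τ) (lift-agreeOn k (λ y → σ≈τ y ∘ inj₂))
subst-anti (∃r k Ψ A)  {Φ} σ≤τ σ≈τ =
  refl ,
  substC-⊨*-mono Ψ (lift-≤ₛ k σ≤τ) (lift-agreeOn k (λ y → σ≈τ y ∘ inj₁))
    (⊨*-++ʳ (wkC k Φ)) ,
  subst-anti A (lift-≤ₛ k σ≤τ) (lift-agreeOn k (λ y → σ≈τ y ∘ inj₂))

substOf-≤ₛ : ∀ {n Φ} (xs : Vec ℕ n) (ps qs : Vec Poly n)
  → ((i : Fin n) → lookup ps i ⊑[ Φ ] lookup qs i) → substOf xs ps ≤ₛ[ Φ ] substOf xs qs
substOf-≤ₛ []       []       []       ps⊑qs y = λ _ _ → ≤-refl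
substOf-≤ₛ (x ∷ xs) (p ∷ ps) (q ∷ qs) ps⊑qs y with y ≟ x
... | yes _ = ps⊑qs fzero
... | no  _ = substOf-≤ₛ xs ps qs (ps⊑qs ∘ fsuc) y

substOf-agreeOn : ∀ {n} (xs : Vec ℕ n) (ps qs : Vec Poly n) {P : ℕ → Set}
  → ((i : Fin n) → ¬ P (lookup xs i)) → AgreeOn P (substOf xs ps) (substOf xs qs)
substOf-agreeOn []       []       []       avoid y Py ρ = refl
substOf-agreeOn (x ∷ xs) (p ∷ ps) (q ∷ qs) avoid y Py ρ with y ≟ x
... | yes refl = ⊥-elim (avoid fzero Py)
... | no  _    = substOf-agreeOn xs ps qs (avoid ∘ fsuc) y Py ρ

lemma2p10 : (A : Form) (Φ : CSet) (n : ℕ) (xs : Vec ℕ n) (ps qs : Vec Poly n)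
    → WF A → IsRPC Φ → All IsRP ps → All IsRP qs
    → ((i j : Fin n) → lookup xs i ≡ lookup xs j → i ≡ j)
    → ((i : Fin n) → ¬ OccC (lookup xs i) Φ)
    → ((i : Fin n) → lookup ps i ⊑[ Φ ] lookup qs i)
    → (((i : Fin n) → ¬ Occ neg (lookup xs i) A) → A [ ps / xs ] ≤[ Φ ] A [ qs / xs ])
      × (((i : Fin n) → ¬ Occ pos (lookup xs i) A) → A [ qs / xs ] ≤[ Φ ] A [ ps / xs ])
lemma2p10 A Φ n xs ps qs _ _ _ _ _ _ ps⊑qs =
  (λ noNeg → subst-mono A ps≤qs (substOf-agreeOn xs ps qs noNeg)) ,
  (λ noPos → subst-anti A ps≤qs (substOf-agreeOn xs ps qs noPos))
  where
  ps≤qs : substOf xs ps ≤ₛ[ Φ ] substOf xs qs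
  ps≤qs = substOf-≤ₛ xs ps qs ps⊑qs
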